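{- Let $\mathcal{F}$ be a union-closed family of finite sets with $\emptyset\in\mathcal{F}$ such that every member of $J(\mathcal{F})$ has one or two elements, let $U=\{a,b\}\in J(\mathcal{F})$ with $a\neq b$, and suppose $\mathcal{F}=\mathcal{N}^3_{\mathcal{F}}(U)$. Let $\mathcal{H}$ be a nonempty order filter (up-set) of $2^{N^2\setminus U}$ such that $|E(X)|=1$ for every minimal member $X$ of $\mathcal{H}$, and let $\mathcal{F}'=\mathcal{F}\vee\mathcal{H}$. Then $$\mu_{\mathcal{F},\mathcal{F}'}(U)\ \ge\ 1+\sum_{Y\subsetneq U}\ \prod_{x\in N\setminus U}\nu(\mathcal{E}(Y,x)).$$
   Context: For families $\mathcal{A},\mathcal{B}$, $\mathcal{A}\vee\mathcal{B}=\{A\cup B:A\in\mathcal{A},B\in\mathcal{B}\}$ and $\mathcal{A}_{\setminus Z}=\{A\setminus Z:A\in\mathcal{A}\}$. $J(\mathcal{F})$ is the set of union generators of $\mathcal{F}$ (nonempty $V\in\mathcal{F}$ not equal to the union of the members of $\mathcal{F}$ properly contained in $V$); its members are called edges. $N_{\mathcal{F}}(X)=X\cup\bigcup\{V\in J(\mathcal{F}):V\cap X\neq\emptyset\}$, $N=N_{\mathcal{F}}(U)$, $N^2=N_{\mathcal{F}}(N)$. $\mathcal{N}_{\mathcal{F}}(W)$ is the family of all unions of subfamilies of $\{V\in J(\mathcal{F}):V\cap W\neq\emptyset\}$ (empty union $=\emptyset$), and $\mathcal{N}^3_{\mathcal{F}}(U)=\mathcal{N}_{\mathcal{F}}(\bigcup\mathcal{N}_{\mathcal{F}}(U))$.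 $\pi_{\mathcal{F}}(X)=\bigcup\{V\in\mathcal{F}:V\subseteq X\}$. For $X$ with $X\cap U=\emptyset$, $E(X)$ is the set of $Y\subseteq U$ with $\pi_{\mathcal{F}}(X\cup Y)\cap U=Y$ and $\pi_{\mathcal{F}}(X\cup Y)\supseteq\pi_{\mathcal{F}}(X\cup U)\setminus U$. $\mu_{\mathcal{F},\mathcal{F}'}(U)=\sum_{X\in\mathcal{F}'_{\setminus U}}|E(X)|\,/\,|\mathcal{F}'_{\setminus U}|$. For $Y\subseteq U$ and $x\in N\setminus U$, $\mathcal{E}(Y,x)$ is the family of subsets $X\subseteq N^2\setminus U$ for which there exists $y$ with $\{x,y\}\in J(\mathcal{F})$ and ($y\in X\cup Y$ or $y=x$). For a family $\mathcal{W}\subseteq 2^{N^2\setminus U}$, $\nu(\mathcal{W})=|\mathcal{W}|/2^{|N^2\setminus U|}$. -}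

module Defs where

open import Data.Bool using (Bool; true; false; _∧_; _∨_; not; if_then_else_)
import Data.Bool.Properties as BoolP
open import Data.Nat using (ℕ; zero; suc; _^_)
open import Data.Fin using (Fin)
open import Data.Fin.Subset using (Subset; inside; outside; _∪_; _∩_; _─_; ⁅_⁆; ∣_∣) renaming (⊥ to ∅)
open import Data.Vec using (Vec; []; _∷_; lookup)
open import Data.Vec.Properties using (≡-dec)
open import Data.List using (List; []; _∷_; map; _++_; filter; length; foldr; allFin)
open import Data.Bool.ListAction using (any; all)
open import Data.Integer using (+_)
open import Data.Rational using (ℚ; _/_; _+_; _*_; 0ℚ; 1ℚ)
open import Relation.Nullary.Decidable using (⌊_⌋)
open import Relation.Unary using (Pred)
open import Relation.Binary.PropositionalEquality using (_≡_)
open import Data.Product using (Σ; _×_)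
open import Data.List.Relation.Unary.All using (All)
open import Level using (0ℓ)

-- Ground set: Fin n.  Sets are `Subset n`; a family of sets is a
-- decidable predicate on `Subset n` (Bool-valued).

Fam : ℕ → Set
Fam n = Subset n → Bool

allSubsets : (n : ℕ) → List (Subset n)
allSubsets zero = [] ∷ []
allSubsets (suc n) = map (inside ∷_) (allSubsets n) ++ map (outside ∷_) (allSubsets n)

_∈ᵇ_ : {n : ℕ} → Fin n → Subset n → Bool
x ∈ᵇ A = lookup A x

_⊆ᵇ_ : {n : ℕ} → Subset n → Subset n → Bool
_⊆ᵇ_ {n} A B = all (λ i → not (lookup A i) ∨ lookup B i) (allFin n)

_≡ᵇ_ : {n : ℕ} → Subset n → Subset n → Bool
A ≡ᵇ B = ⌊ ≡-dec BoolP._≟_ A B ⌋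

_⊂ᵇ_ : {n : ℕ} → Subset n → Subset n → Bool
A ⊂ᵇ B = (A ⊆ᵇ B) ∧ not (A ≡ᵇ B)

nonemptyᵇ : {n : ℕ} → Subset n → Bool
nonemptyᵇ A = not (A ≡ᵇ ∅)

meetsᵇ : {n : ℕ} → Subset n → Subset n → Bool
meetsᵇ A B = nonemptyᵇ (A ∩ B)

⋃ : {n : ℕ} → List (Subset n) → Subset n
⋃ = foldr _∪_ ∅

members : {n : ℕ} → Fam n → List (Subset n)
members {n} 𝓕 = filter (λ A → BoolP.T? (𝓕 A)) (allSubsets n)

card : {n : ℕ} → Fam n → ℕ
card 𝓕 = length (members 𝓕)

J : {n : ℕ} → Fam n → Fam n
J 𝓕 V = 𝓕 V ∧ nonemptyᵇ V ∧ not (V ≡ᵇ ⋃ (members (λ W → 𝓕 W ∧ (W ⊂ᵇ V))))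

Nb : {n : ℕ} → Fam n → Subset n → Subset n
Nb 𝓕 X = X ∪ ⋃ (members (λ V → J 𝓕 V ∧ meetsᵇ V X))

-- 𝒩_F(W): all unions of subfamilies of {V ∈ J(F) : V ∩ W ≠ ∅}
-- (a finite subfamily is given as a list; the empty union is ∅)
𝒩 : {n : ℕ} → Fam n → Subset n → Pred (Subset n) 0ℓ
𝒩 𝓕 W A = Σ (List (Subset _)) λ Vs →
  All (λ V → (J 𝓕 V ∧ meetsᵇ V W) ≡ true) Vs × (A ≡ ⋃ Vs)

-- 𝒩³_F(U) = 𝒩_F(⋃ 𝒩_F(U)).  The union of all members of 𝒩_F(U) is
-- the union of the full subfamily, i.e. of all edges meeting U.
𝒩³ : {n : ℕ} → Fam n → Subset n → Pred (Subset n) 0ℓ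
𝒩³ 𝓕 U = 𝒩 𝓕 (⋃ (members (λ V → J 𝓕 V ∧ meetsᵇ V U)))

π : {n : ℕ} → Fam n → Subset n → Subset n
π 𝓕 X = ⋃ (members (λ V → 𝓕 V ∧ (V ⊆ᵇ X)))

E : {n : ℕ} → Fam n → Subset n → Subset n → Fam n
E 𝓕 U X Y = (Y ⊆ᵇ U) ∧ ((π 𝓕 (X ∪ Y) ∩ U) ≡ᵇ Y)
            ∧ ((π 𝓕 (X ∪ U) ─ U) ⊆ᵇ π 𝓕 (X ∪ Y))

_∨ᶠ_ : {n : ℕ} → Fam n → Fam n → Fam n
_∨ᶠ_ {n} 𝓐 𝓑 C = any (λ A → any (λ B → C ≡ᵇ (A ∪ B)) (members 𝓑)) (members 𝓐)

_∖ᶠ_ : {n : ℕ} → Fam n → Subset n → Fam n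
(𝓐 ∖ᶠ Z) C = any (λ A → C ≡ᵇ (A ─ Z)) (members 𝓐)

-- a / b as a rational, with the convention a / 0 = 0 (only used with
-- nonzero denominators in the theorem)
frac : ℕ → ℕ → ℚ
frac a zero = 0ℚ
frac a (suc b) = (+ a) / suc b

sumℕ : List ℕ → ℕ
sumℕ = foldr Data.Nat._+_ 0

sumℚ : List ℚ → ℚ
sumℚ = foldr _+_ 0ℚ

prodℚ : List ℚ → ℚ
prodℚ = foldr _*_ 1ℚ

μ : {n : ℕ} → Fam n → Fam n → Subset n → ℚ
μ 𝓕 𝓕' U = frac (sumℕ (map (λ X → card (E 𝓕 U X)) (members (𝓕' ∖ᶠ U))))
                (card (𝓕' ∖ᶠ U))

ℰ : {n : ℕ} → Fam n → Subset n → Subset n → Fin n → Fam n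
ℰ {n} 𝓕 U Y x X =
  (X ⊆ᵇ (Nb 𝓕 (Nb 𝓕 U) ─ U)) ∧
  any (λ y → J 𝓕 (⁅ x ⁆ ∪ ⁅ y ⁆) ∧ ((y ∈ᵇ (X ∪ Y)) ∨ ⌊ y Data.Fin.≟ x ⌋)) (allFin n)

ν : {n : ℕ} → Fam n → Subset n → Fam n → ℚ
ν 𝓕 U 𝒲 = frac (card 𝒲) (2 ^ ∣ Nb 𝓕 (Nb 𝓕 U) ─ U ∣)

rhs : {n : ℕ} → Fam n → Subset n → ℚ
rhs {n} 𝓕 U =
  1ℚ + sumℚ (map (λ Y → prodℚ (map (λ x → ν 𝓕 U (ℰ 𝓕 U Y x))
                                   (filter (λ x → BoolP.T? (x ∈ᵇ (Nb 𝓕 U ─ U))) (allFin n))))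
                 (members (λ Y → Y ⊂ᵇ U)))

pair : {n : ℕ} → Fin n → Fin n → Subset n
pair a b = ⁅ a ⁆ ∪ ⁅ b ⁆

N²∖ : {n : ℕ} → Fam n → Subset n → Subset n
N²∖ 𝓕 U = Nb 𝓕 (Nb 𝓕 U) ─ U

-- Let D = N² ∖ U. Since 𝓕 = 𝒩³(U), every member of 𝓕 lies in N², so (𝓕 ∨ 𝓗) ∖ U = 𝓗 and μ is the
-- average of |E(X)| over X ∈ 𝓗. Each E(X) contains U. Every u ∈ U is covered by an edge inside X ∪ {u}:
-- otherwise, for a minimal X₀ ⊆ X in 𝓗, the trace on U of π(X₀ ∪ (U - u)) would be a second member of
-- E(X₀). Consequently a proper subset Y ⊊ U belongs to E(X) whenever X lies in every ℰ(Y, x), so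
-- |E(X)| ≥ 1 + #{Y ⊊ U : X ∈ ⋂ₓ ℰ(Y, x)}. Averaging over 𝓗, it remains to bound |𝓗 ∩ ⋂ₓ ℰ(Y, x)| / |𝓗|
-- from below by ∏ₓ ν(ℰ(Y, x)), which is the Harris–Kleitman inequality for the up-sets 𝓗 and ℰ(Y, x)
-- of 2^D.

module Submission where

module BooleanReflection where

  open import Data.Bool using (Bool; true; false; _∨_; not)
  open import Data.Bool.Properties using (T?; T-≡; ∨-zeroʳ; not-injective; not-¬)
  open import Data.Empty using (⊥-elim)
  open import Data.Fin using (Fin)
  open import Data.Fin.Subset using (Subset; inside; outside; _∈_; _∉_; _⊆_; _∪_; _∩_; _─_)
    renaming (⊥ to ∅)
  open import Data.Fin.Subset.Properties using (x∈p∪q⁻; x∈p∪q⁺; x∈p∩q⁻; x∈p∩q⁺; ∉⊥; nonempty?; Empty-unique)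
  open import Data.List using (List; []; _∷_; map; allFin)
  open import Data.List.Membership.Propositional using (find) renaming (_∈_ to _∈ₗ_)
  open import Data.List.Membership.Propositional.Properties
    using (∈-allFin; ∈-map⁺; ∈-++⁺ˡ; ∈-++⁺ʳ; ∈-filter⁺; ∈-filter⁻)
  open import Data.List.Relation.Unary.Any as Any using (here; there)
  import Data.List.Relation.Unary.All as All
  open import Data.List.Relation.Unary.All.Properties using (all⁺; all⁻)
  open import Data.List.Relation.Unary.Any.Properties using (any⁺; any⁻)
  open import Data.Bool.ListAction using (any; all)
  open import Data.Nat using (ℕ; suc)
  open import Data.Product using (∃-syntax; _×_; _,_)
  open import Data.Sum using (_⊎_; inj₁; inj₂)
  open import Data.Vec using (lookup; []; _∷_; here; there)
  open import Data.Vec.Properties using ([]=⇒lookup; lookup⇒[]=)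
  open import Function using (_∘_; Equivalence)
  open import Relation.Nullary using (yes; no)
  open import Relation.Nullary.Decidable using (toWitness; fromWitness)
  open import Relation.Binary.PropositionalEquality using (_≡_; refl; subst)
  open import Defs

  private variable
    α : Set
    n : ℕ
    p q : Subset n
    x : Fin n

  open Equivalence

  ∨-true⁻ : ∀ {b c} → (b ∨ c) ≡ true → b ≡ true ⊎ c ≡ true
  ∨-true⁻ {true} _ = inj₁ refl
  ∨-true⁻ {false} c = inj₂ c

  ∨-trueʳ : ∀ b {c} → c ≡ true → (b ∨ c) ≡ true
  ∨-trueʳ b refl = ∨-zeroʳ b

  all-true⁻ : (f : α → Bool) (xs : List α) → all f xs ≡ true → ∀ {x} → x ∈ₗ xs → f x ≡ true
  all-true⁻ f xs h x∈ = to T-≡ (All.lookup (all⁺ f xs (from T-≡ h)) x∈)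

  all-true⁺ : (f : α → Bool) (xs : List α) → (∀ {x} → x ∈ₗ xs → f x ≡ true) → all f xs ≡ true
  all-true⁺ f xs h = to T-≡ (all⁻ f (All.tabulate (from T-≡ ∘ h)))

  any-true⁻ : (f : α → Bool) (xs : List α) → any f xs ≡ true → ∃[ x ] x ∈ₗ xs × f x ≡ true
  any-true⁻ f xs h with find (any⁻ f xs (from T-≡ h))
  ... | x , x∈ , fx = x , x∈ , to T-≡ fx

  any-true⁺ : (f : α → Bool) {xs : List α} {x : α} → x ∈ₗ xs → f x ≡ true → any f xs ≡ true
  any-true⁺ f x∈ fx = to T-≡ (any⁺ f (Any.map (λ { refl → from T-≡ fx }) x∈))

  ∈ᵇ⇒∈ : (x ∈ᵇ p) ≡ true → x ∈ p
  ∈ᵇ⇒∈ {x = x} {p = p} = lookup⇒[]= x p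

  ∈⇒∈ᵇ : x ∈ p → (x ∈ᵇ p) ≡ true
  ∈⇒∈ᵇ = []=⇒lookup

  ⊆ᵇ⇒⊆ : (p ⊆ᵇ q) ≡ true → p ⊆ q
  ⊆ᵇ⇒⊆ {n} {p} {q} h {x} x∈p with all-true⁻ _ (allFin n) h (∈-allFin x)
  ... | ¬x∈p∨x∈q rewrite ∈⇒∈ᵇ x∈p = ∈ᵇ⇒∈ ¬x∈p∨x∈q

  ⊆⇒⊆ᵇ : p ⊆ q → (p ⊆ᵇ q) ≡ true
  ⊆⇒⊆ᵇ {n} {p} {q} p⊆q = all-true⁺ _ (allFin n) λ {x} _ → implication x
    where
    implication : ∀ x → (not (x ∈ᵇ p) ∨ (x ∈ᵇ q)) ≡ true
    implication x with x ∈ᵇ p in eq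
    ... | true = ∈⇒∈ᵇ (p⊆q (∈ᵇ⇒∈ eq))
    ... | false = refl

  ≡ᵇ⇒≡ : (p ≡ᵇ q) ≡ true → p ≡ q
  ≡ᵇ⇒≡ h = toWitness (from T-≡ h)

  ≡⇒≡ᵇ : p ≡ q → (p ≡ᵇ q) ≡ true
  ≡⇒≡ᵇ p≡q = to T-≡ (fromWitness p≡q)

  meetsᵇ⇒ : meetsᵇ p q ≡ true → ∃[ x ] x ∈ p × x ∈ q
  meetsᵇ⇒ {p = p} {q} h with nonempty? (p ∩ q)
  ... | yes (x , x∈p∩q) = x , x∈p∩q⁻ p q x∈p∩q
  ... | no empty = ⊥-elim (not-¬ (≡⇒≡ᵇ (Empty-unique empty)) (not-injective h))

  meetsᵇ⇐ : x ∈ p → x ∈ q → meetsᵇ p q ≡ true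
  meetsᵇ⇐ {x = x} {p = p} {q} x∈p x∈q with (p ∩ q) ≡ᵇ ∅ in eq
  ... | true = ⊥-elim (∉⊥ (subst (x ∈_) (≡ᵇ⇒≡ eq) (x∈p∩q⁺ (x∈p , x∈q))))
  ... | false = refl

  ∈⋃⁻ : (Vs : List (Subset n)) → x ∈ ⋃ Vs → ∃[ V ] V ∈ₗ Vs × x ∈ V
  ∈⋃⁻ [] x∈ = ⊥-elim (∉⊥ x∈)
  ∈⋃⁻ (V ∷ Vs) x∈ with x∈p∪q⁻ V (⋃ Vs) x∈
  ... | inj₁ x∈V = V , here refl , x∈V
  ... | inj₂ x∈⋃ with ∈⋃⁻ Vs x∈⋃
  ...   | W , W∈ , x∈W = W , there W∈ , x∈W

  ∈⋃⁺ : {V : Subset n} {Vs : List (Subset n)} → V ∈ₗ Vs → x ∈ V → x ∈ ⋃ Vs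
  ∈⋃⁺ (here refl) x∈V = x∈p∪q⁺ (inj₁ x∈V)
  ∈⋃⁺ (there V∈) x∈V = x∈p∪q⁺ (inj₂ (∈⋃⁺ V∈ x∈V))

  ∈-allSubsets : (p : Subset n) → p ∈ₗ allSubsets n
  ∈-allSubsets [] = here refl
  ∈-allSubsets {suc n} (inside ∷ p) = ∈-++⁺ˡ (∈-map⁺ (inside ∷_) (∈-allSubsets p))
  ∈-allSubsets {suc n} (outside ∷ p) =
    ∈-++⁺ʳ (map (inside ∷_) (allSubsets n)) (∈-map⁺ (outside ∷_) (∈-allSubsets p))

  ∈-members⁺ : (𝓕 : Fam n) → 𝓕 p ≡ true → p ∈ₗ members 𝓕
  ∈-members⁺ {p = p} 𝓕 h = ∈-filter⁺ (T? ∘ 𝓕) (∈-allSubsets p) (from T-≡ h)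

  ∈-members⁻ : (𝓕 : Fam n) → p ∈ₗ members 𝓕 → 𝓕 p ≡ true
  ∈-members⁻ {n} 𝓕 p∈ with ∈-filter⁻ (T? ∘ 𝓕) {xs = allSubsets n} p∈
  ... | _ , h = to T-≡ h

  x∈p─q⇒x∉q : (p q : Subset n) → x ∈ p ─ q → x ∉ q
  x∈p─q⇒x∉q (_ ∷ p) (inside ∷ q) () here
  x∈p─q⇒x∉q (_ ∷ p) (_ ∷ q) (there x∈p─q) (there x∈q) = x∈p─q⇒x∉q p q x∈p─q x∈q

module Counting where

  open import Data.Bool using (Bool; true; false; _∧_; not; T?)
  open import Data.Bool.Properties using (∧-comm)
  open import Data.List using (List; []; _∷_; map; _++_; filter; length)
  open import Data.List.Properties using (map-cong)
  open import Data.Nat.ListAction using (sum)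
  open import Data.List.Membership.Propositional using () renaming (_∈_ to _∈ₗ_)
  open import Data.List.Relation.Unary.Any using (here; there)
  open import Data.Nat using (ℕ; suc; _+_; _≤_; z≤n; s≤s)
  open import Data.Nat.Properties using (+-mono-≤; ≤-trans; m≤n+m; +-assoc; +-commutativeSemigroup)
  open import Algebra.Properties.CommutativeSemigroup +-commutativeSemigroup using (interchange)
  open import Relation.Binary.PropositionalEquality using (_≡_; refl; sym; trans; cong; cong₂; module ≡-Reasoning)

  private variable
    α β : Set

  χ : Bool → ℕ
  χ true = 1
  χ false = 0

  count : (α → Bool) → List α → ℕ
  count f [] = 0
  count f (x ∷ xs) = χ (f x) + count f xs

  module _ (f g : α → ℕ) where

    sum-map-mono : (∀ x → f x ≤ g x) → ∀ xs → sum (map f xs) ≤ sum (map g xs)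
    sum-map-mono f≤g [] = z≤n
    sum-map-mono f≤g (x ∷ xs) = +-mono-≤ (f≤g x) (sum-map-mono f≤g xs)

    sum-map-+ : ∀ xs → sum (map (λ x → f x + g x) xs) ≡ sum (map f xs) + sum (map g xs)
    sum-map-+ [] = refl
    sum-map-+ (x ∷ xs) = begin
      (f x + g x) + sum (map (λ x → f x + g x) xs)      ≡⟨ cong ((f x + g x) +_) (sum-map-+ xs) ⟩
      (f x + g x) + (sum (map f xs) + sum (map g xs))  ≡⟨ interchange (f x) (g x) _ _ ⟩
      (f x + sum (map f xs)) + (g x + sum (map g xs))  ∎
      where open ≡-Reasoning

  sum-map-swap : (r : α → β → ℕ) (xs : List α) (ys : List β) →
    sum (map (λ x → sum (map (r x) ys)) xs) ≡ sum (map (λ y → sum (map (λ x → r x y) xs)) ys)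
  sum-map-swap r [] ys = sym (sum-map-zero ys)
    where
    sum-map-zero : ∀ ys → sum (map (λ _ → 0) ys) ≡ 0
    sum-map-zero [] = refl
    sum-map-zero (_ ∷ ys) = sum-map-zero ys
  sum-map-swap r (x ∷ xs) ys = trans (cong (sum (map (r x) ys) +_) (sum-map-swap r xs ys))
    (sym (sum-map-+ (r x) (λ y → sum (map (λ x → r x y) xs)) ys))

  sum-map-one : (xs : List α) → sum (map (λ _ → 1) xs) ≡ length xs
  sum-map-one [] = refl
  sum-map-one (_ ∷ xs) = cong suc (sum-map-one xs)

  module _ (f : α → Bool) where

    length-filter : ∀ xs → length (filter (λ x → T? (f x)) xs) ≡ count f xs
    length-filter [] = refl
    length-filter (x ∷ xs) with f x
    ... | true = cong suc (length-filter xs)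
    ... | false = length-filter xs

    count-pos : ∀ {x xs} → x ∈ₗ xs → f x ≡ true → 1 ≤ count f xs
    count-pos (here refl) fx rewrite fx = s≤s z≤n
    count-pos {xs = y ∷ _} (there x∈) fx = ≤-trans (count-pos x∈ fx) (m≤n+m _ (χ (f y)))

    count-filter : (g : α → Bool) → ∀ xs → count f (filter (λ x → T? (g x)) xs) ≡ count (λ x → g x ∧ f x) xs
    count-filter g [] = refl
    count-filter g (x ∷ xs) with g x
    ... | true = cong (χ (f x) +_) (count-filter g xs)
    ... | false = count-filter g xs

    count-split : (g : α → Bool) → ∀ xs →
      count f xs ≡ count (λ x → f x ∧ g x) xs + count (λ x → f x ∧ not (g x)) xs
    count-split g [] = refl
    count-split g (x ∷ xs) = trans (cong₂ _+_ (χ-split (f x) (g x)) (count-split g xs))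
                                   (interchange (χ (f x ∧ g x)) (χ (f x ∧ not (g x))) _ _)
      where
      χ-split : ∀ a b → χ a ≡ χ (a ∧ b) + χ (a ∧ not b)
      χ-split true true = refl
      χ-split true false = refl
      χ-split false b = refl

    count≡sum : ∀ xs → count f xs ≡ sum (map (λ x → χ (f x)) xs)
    count≡sum [] = refl
    count≡sum (x ∷ xs) = cong (χ (f x) +_) (count≡sum xs)

  count-mono : (f g : α → Bool) → (∀ x → f x ≡ true → g x ≡ true) → ∀ xs → count f xs ≤ count g xs
  count-mono f g f⇒g [] = z≤n
  count-mono f g f⇒g (x ∷ xs) = +-mono-≤ (χ-mono (f⇒g x)) (count-mono f g f⇒g xs)
    where
    χ-mono : ∀ {a b} → (a ≡ true → b ≡ true) → χ a ≤ χ b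
    χ-mono {false} _ = z≤n
    χ-mono {true} a⇒b rewrite a⇒b refl = s≤s z≤n

  count-cong : {f g : α → Bool} → (∀ x → f x ≡ g x) → ∀ xs → count f xs ≡ count g xs
  count-cong f≗g [] = refl
  count-cong f≗g (x ∷ xs) = cong₂ _+_ (cong χ (f≗g x)) (count-cong f≗g xs)

  count-none : (f : α → Bool) → (∀ x → f x ≡ false) → ∀ xs → count f xs ≡ 0
  count-none f none [] = refl
  count-none f none (x ∷ xs) rewrite none x = count-none f none xs

  module _ (f : α → Bool) where

    count-++ : ∀ xs ys → count f (xs ++ ys) ≡ count f xs + count f ys
    count-++ [] ys = refl
    count-++ (x ∷ xs) ys = trans (cong (χ (f x) +_) (count-++ xs ys)) (sym (+-assoc (χ (f x)) _ _))

    count-map : (g : β → α) → ∀ xs → count f (map g xs) ≡ count (λ x → f (g x)) xs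
    count-map g [] = refl
    count-map g (x ∷ xs) = cong (χ (f (g x)) +_) (count-map g xs)

  count-partition : (f g : α → Bool) → ∀ xs →
    count f xs ≡ count f (filter (λ x → T? (g x)) xs) + count (λ x → f x ∧ not (g x)) xs
  count-partition f g xs = trans (count-split f g xs)
    (cong (_+ count (λ x → f x ∧ not (g x)) xs)
          (trans (count-cong (λ x → ∧-comm (f x) (g x)) xs) (sym (count-filter f g xs))))

  count-swap : (r : α → β → Bool) (xs : List α) (ys : List β) →
    sum (map (λ x → count (r x) ys) xs) ≡ sum (map (λ y → count (λ x → r x y) xs) ys)
  count-swap r xs ys = begin
    sum (map (λ x → count (r x) ys) xs)
      ≡⟨ cong sum (map-cong (λ x → count≡sum (r x) ys) xs) ⟩
    sum (map (λ x → sum (map (λ y → χ (r x y)) ys)) xs)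
      ≡⟨ sum-map-swap (λ x y → χ (r x y)) xs ys ⟩
    sum (map (λ y → sum (map (λ x → χ (r x y)) xs)) ys)
      ≡⟨ cong sum (map-cong (λ y → count≡sum (λ x → r x y) xs) ys) ⟨
    sum (map (λ y → count (λ x → r x y) xs) ys) ∎
    where open ≡-Reasoning

module HarrisKleitman where

  open import Data.Bool using (Bool; true; false; _∧_)
  open import Data.Bool.Properties using (∧-conicalˡ; ∧-conicalʳ; ∧-assoc; ∧-comm; ∧-identityʳ)
  open import Data.Fin.Subset using (Subset; inside; outside; _⊆_; ∣_∣)
  open import Data.Fin.Subset.Properties using (drop-∷-⊆; s⊆s; out⊆; ⊆-refl)
  open import Data.List using ([]; _∷_; map; _++_; length)
  open import Data.Nat using (ℕ; suc; _+_; _*_; _^_; _≤_; z≤n; s≤s)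
  open import Data.Nat.ListAction using (product)
  open import Data.Nat.Properties
    using (≤-trans; ≤-reflexive; m≤m+n; +-mono-≤; *-monoʳ-≤; *-monoˡ-≤; *-assoc; m≤n⇒∃[o]m+o≡n; module ≤-Reasoning)
  open import Data.Nat.Solver using (module +-*-Solver)
  open import Data.Product using (_,_)
  open import Data.Vec using ([]; _∷_; here)
  open import Relation.Binary.PropositionalEquality using (_≡_; refl; sym; trans; cong; cong₂)
  open import Data.Bool.ListAction using (all)
  open import Defs using (allSubsets)
  open Counting
  open +-*-Solver

  private variable
    n : ℕ

  UpwardClosedIn : Subset n → (Subset n → Bool) → Set
  UpwardClosedIn D f = ∀ {X Y} → f X ≡ true → X ⊆ Y → Y ⊆ D → f Y ≡ true

  record UpSetIn (D : Subset n) (f : Subset n → Bool) : Set where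
    field
      bounded : ∀ {X} → f X ≡ true → X ⊆ D
      upward : UpwardClosedIn D f

  open UpSetIn

  #_ : (Subset n → Bool) → ℕ
  #_ {n} f = count f (allSubsets n)

  #-split : (f : Subset (suc n) → Bool) → # f ≡ # (λ X → f (inside ∷ X)) + # (λ X → f (outside ∷ X))
  #-split {n} f = trans (count-++ f (map (inside ∷_) Xs) (map (outside ∷_) Xs))
    (cong₂ _+_ (count-map f (inside ∷_) Xs) (count-map f (outside ∷_) Xs))
    where Xs = allSubsets n

  module _ {D : Subset n} {f : Subset (suc n) → Bool} where

    restrict-outside : ∀ {d} → UpSetIn (d ∷ D) f → UpSetIn D (λ X → f (outside ∷ X))
    restrict-outside up = record
      { bounded = λ fX → drop-∷-⊆ (bounded up fX)
      ; upward = λ fX X⊆Y Y⊆D → upward up fX (s⊆s X⊆Y) (out⊆ Y⊆D)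
      }

    restrict-inside : UpSetIn (inside ∷ D) f → UpSetIn D (λ X → f (inside ∷ X))
    restrict-inside up = record
      { bounded = λ fX → drop-∷-⊆ (bounded up fX)
      ; upward = λ fX X⊆Y Y⊆D → upward up fX (s⊆s X⊆Y) (s⊆s Y⊆D)
      }

    outside⇒inside : UpSetIn (inside ∷ D) f → ∀ X → f (outside ∷ X) ≡ true → f (inside ∷ X) ≡ true
    outside⇒inside up X fX = upward up fX (out⊆ ⊆-refl) (s⊆s (drop-∷-⊆ (bounded up fX)))

    inside-excluded : UpSetIn (outside ∷ D) f → ∀ X → f (inside ∷ X) ≡ false
    inside-excluded up X with f (inside ∷ X) in fX
    ... | false = refl
    ... | true with bounded up fX here
    ... | ()

  chebyshev₂ : ∀ {a₀ a₁ b₀ b₁} → a₀ ≤ a₁ → b₀ ≤ b₁ → (a₁ + a₀) * (b₁ + b₀) ≤ 2 * (a₁ * b₁ + a₀ * b₀)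
  chebyshev₂ {a₀} {_} {b₀} a₀≤a₁ b₀≤b₁ with m≤n⇒∃[o]m+o≡n a₀≤a₁ | m≤n⇒∃[o]m+o≡n b₀≤b₁
  ... | x , refl | y , refl = ≤-trans (m≤m+n _ (x * y)) (≤-reflexive
    (solve 4 (λ a b x y → ((a :+ x) :+ a) :* ((b :+ y) :+ b) :+ x :* y
                           := con 2 :* ((a :+ x) :* (b :+ y) :+ a :* b)) refl a₀ b₀ x y))

  harris-kleitman : (D : Subset n) {f g : Subset n → Bool} → UpSetIn D f → UpSetIn D g →
    # f * # g ≤ # (λ X → f X ∧ g X) * 2 ^ ∣ D ∣
  harris-kleitman [] {f} {g} _ _ with f [] | g []
  ... | true | true = s≤s z≤n
  ... | true | false = z≤n
  ... | false | _ = z≤n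
  harris-kleitman {suc n} (outside ∷ D) {f} {g} upf upg
    rewrite #-split f | #-split g | #-split (λ X → f X ∧ g X)
          | count-none _ (inside-excluded upf) (allSubsets n)
          | count-none _ (inside-excluded upg) (allSubsets n)
          | count-none _ (λ X → cong (_∧ g (inside ∷ X)) (inside-excluded upf X)) (allSubsets n)
    = harris-kleitman D (restrict-outside upf) (restrict-outside upg)
  harris-kleitman {suc n} (inside ∷ D) {f} {g} upf upg
    rewrite #-split f | #-split g | #-split (λ X → f X ∧ g X) = begin
      (# f₁ + # f₀) * (# g₁ + # g₀)
        ≤⟨ chebyshev₂ (count-mono f₀ f₁ (outside⇒inside upf) (allSubsets n))
                     (count-mono g₀ g₁ (outside⇒inside upg) (allSubsets n)) ⟩
      2 * (# f₁ * # g₁ + # f₀ * # g₀)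
        ≤⟨ *-monoʳ-≤ 2 (+-mono-≤ (harris-kleitman D (restrict-inside upf) (restrict-inside upg))
                                  (harris-kleitman D (restrict-outside upf) (restrict-outside upg))) ⟩
      2 * (c₁ * Q + c₀ * Q)
        ≡⟨ solve 3 (λ c₁ c₀ Q → con 2 :* (c₁ :* Q :+ c₀ :* Q) := (c₁ :+ c₀) :* (con 2 :* Q)) refl c₁ c₀ Q ⟩
      (c₁ + c₀) * (2 * Q) ∎
    where
    open ≤-Reasoning
    Q = 2 ^ ∣ D ∣
    f₀ f₁ g₀ g₁ : Subset n → Bool
    f₀ X = f (outside ∷ X)
    f₁ X = f (inside ∷ X)
    g₀ X = g (outside ∷ X)
    g₁ X = g (inside ∷ X)
    c₀ = # (λ X → f₀ X ∧ g₀ X)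
    c₁ = # (λ X → f₁ X ∧ g₁ X)

  ∧-upSetIn : ∀ {D : Subset n} {f g} → UpSetIn D f → UpwardClosedIn D g → UpSetIn D (λ X → f X ∧ g X)
  ∧-upSetIn {f = f} up upg = record
    { bounded = λ fgX → bounded up (∧-conicalˡ _ _ fgX)
    ; upward = λ {X} fgX X⊆Y Y⊆D → cong₂ _∧_ (upward up (∧-conicalˡ _ _ fgX) X⊆Y Y⊆D)
                                             (upg (∧-conicalʳ (f X) _ fgX) X⊆Y Y⊆D)
    }

  module _ {ι : Set} {D : Subset n} {P : ι → Subset n → Bool} (upP : ∀ i → UpSetIn D (P i)) where

    all-upwardClosed : ∀ is → UpwardClosedIn D (λ X → all (λ i → P i X) is)
    all-upwardClosed [] _ _ _ = refl
    all-upwardClosed (i ∷ is) {X} PX X⊆Y Y⊆D =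
      cong₂ _∧_ (upward (upP i) (∧-conicalˡ _ _ PX) X⊆Y Y⊆D)
                (all-upwardClosed is (∧-conicalʳ (P i X) _ PX) X⊆Y Y⊆D)

    harris-kleitman-all : {h : Subset n → Bool} → UpSetIn D h → ∀ is →
      # h * product (map (λ i → # (P i)) is) ≤ # (λ X → h X ∧ all (λ i → P i X) is) * (2 ^ ∣ D ∣) ^ length is
    harris-kleitman-all {h} uph [] =
      ≤-reflexive (cong (_* 1) (count-cong (λ X → sym (∧-identityʳ (h X))) (allSubsets n)))
    harris-kleitman-all {h} uph (i ∷ is) = begin
      # h * (# (P i) * Π)         ≡⟨ solve 3 (λ a b c → a :* (b :* c) := b :* (a :* c)) refl (# h) (# (P i)) Π ⟩
      # (P i) * (# h * Π)         ≤⟨ *-monoʳ-≤ (# (P i)) (harris-kleitman-all uph is) ⟩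
      # (P i) * (# G * Qᵏ)        ≡⟨ solve 3 (λ a b c → a :* (b :* c) := (b :* a) :* c) refl (# (P i)) (# G) Qᵏ ⟩
      (# G * # (P i)) * Qᵏ
        ≤⟨ *-monoˡ-≤ Qᵏ (harris-kleitman D (∧-upSetIn uph (all-upwardClosed is)) (upP i)) ⟩
      (# (λ X → G X ∧ P i X) * Q) * Qᵏ
        ≡⟨ cong (λ c → c * Q * Qᵏ) (count-cong (λ X → ∧-rotate (h X) _ (P i X)) (allSubsets n)) ⟩
      (# (λ X → h X ∧ all (λ j → P j X) (i ∷ is)) * Q) * Qᵏ
        ≡⟨ *-assoc (# (λ X → h X ∧ all (λ j → P j X) (i ∷ is))) Q Qᵏ ⟩
      # (λ X → h X ∧ all (λ j → P j X) (i ∷ is)) * (Q * Qᵏ) ∎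
      where
      open ≤-Reasoning
      Π = product (map (λ i → # (P i)) is)
      Q = 2 ^ ∣ D ∣
      Qᵏ = Q ^ length is
      G : Subset n → Bool
      G X = h X ∧ all (λ j → P j X) is
      ∧-rotate : ∀ a b c → (a ∧ b) ∧ c ≡ a ∧ (c ∧ b)
      ∧-rotate a b c = trans (∧-assoc a b c) (cong (a ∧_) (∧-comm b c))

module Fractions where

  open import Data.Integer using (+_)
  import Data.Integer as ℤ
  import Data.Integer.Properties as ℤ
  open import Data.List using (List; []; _∷_; map; length)
  open import Data.List.Membership.Propositional using () renaming (_∈_ to _∈ₗ_)
  open import Data.List.Relation.Unary.Any using (here; there)
  open import Data.Nat as ℕ using (ℕ; suc; _^_)
  import Data.Nat.Properties as ℕ
  open import Data.Nat.ListAction using (sum; product)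
  open import Data.Nat.Solver using (module +-*-Solver)
  open import Data.Product using (∃-syntax; _×_; _,_)
  open import Function using (_∘_)
  open import Data.Rational using (ℚ; _+_; _*_; _≤_; 0ℚ; 1ℚ; toℚᵘ)
  import Data.Rational.Properties as ℚ
  open import Data.Rational.Unnormalised as ℚᵘ using (mkℚᵘ; *≡*; *≤*)
  import Data.Rational.Unnormalised.Properties as ℚᵘ
  open import Relation.Binary.PropositionalEquality using (_≡_; refl; sym; trans; cong; cong₂; subst₂)
  open import Defs using (frac; sumℚ; prodℚ)
  open +-*-Solver

  private variable
    α β : Set

  -- mkℚᵘ (+ a) b denotes a / (b + 1).
  toℚᵘ-frac : ∀ a b → toℚᵘ (frac a (suc b)) ℚᵘ.≃ mkℚᵘ (+ a) b
  toℚᵘ-frac a b = ℚ.toℚᵘ-fromℚᵘ (mkℚᵘ (+ a) b)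

  mkℚᵘ-cong : ∀ {a b c d} → a ℕ.* suc d ≡ c ℕ.* suc b → mkℚᵘ (+ a) b ℚᵘ.≃ mkℚᵘ (+ c) d
  mkℚᵘ-cong {a} {b} {c} {d} eq = *≡* (trans (sym (ℤ.pos-* a (suc d))) (trans (cong +_ eq) (ℤ.pos-* c (suc b))))

  frac-cong : ∀ {a b c d} → a ℕ.* suc d ≡ c ℕ.* suc b → frac a (suc b) ≡ frac c (suc d)
  frac-cong {a} {b} {c} {d} eq = ℚ.toℚᵘ-injective
    (ℚᵘ.≃-trans (toℚᵘ-frac a b) (ℚᵘ.≃-trans (mkℚᵘ-cong eq) (ℚᵘ.≃-sym (toℚᵘ-frac c d))))

  frac-mono : ∀ a b c d → a ℕ.* suc d ℕ.≤ c ℕ.* suc b → frac a (suc b) ≤ frac c (suc d)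
  frac-mono a b c d le = ℚ.toℚᵘ-cancel-≤ (ℚᵘ.≤-respʳ-≃ (ℚᵘ.≃-sym (toℚᵘ-frac c d))
    (ℚᵘ.≤-respˡ-≃ (ℚᵘ.≃-sym (toℚᵘ-frac a b))
      (*≤* (subst₂ ℤ._≤_ (ℤ.pos-* a (suc d)) (ℤ.pos-* c (suc b)) (ℤ.+≤+ le)))))

  frac-* : ∀ a b c d → frac a (suc b) * frac c (suc d) ≡ frac (a ℕ.* c) (suc b ℕ.* suc d)
  frac-* a b c d = ℚ.toℚᵘ-injective (ℚᵘ.≃-trans (ℚ.toℚᵘ-homo-* (frac a (suc b)) (frac c (suc d)))
    (ℚᵘ.≃-trans (ℚᵘ.*-cong (toℚᵘ-frac a b) (toℚᵘ-frac c d))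
    (ℚᵘ.≃-trans (ℚᵘ.≃-reflexive (cong (λ z → mkℚᵘ z (d ℕ.+ b ℕ.* suc d)) (sym (ℤ.pos-* a c))))
    (ℚᵘ.≃-sym (toℚᵘ-frac (a ℕ.* c) (d ℕ.+ b ℕ.* suc d))))))

  frac-+ : ∀ a c q → frac a (suc q) + frac c (suc q) ≡ frac (a ℕ.+ c) (suc q)
  frac-+ a c q = ℚ.toℚᵘ-injective (ℚᵘ.≃-trans (ℚ.toℚᵘ-homo-+ (frac a (suc q)) (frac c (suc q)))
    (ℚᵘ.≃-trans (ℚᵘ.+-cong (toℚᵘ-frac a q) (toℚᵘ-frac c q))
    (ℚᵘ.≃-trans (ℚᵘ.≃-reflexive (cong (λ z → mkℚᵘ z (q ℕ.+ q ℕ.* suc q))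
        (trans (cong₂ ℤ._+_ (sym (ℤ.pos-* a (suc q))) (sym (ℤ.pos-* c (suc q))))
               (sym (ℤ.pos-+ (a ℕ.* suc q) (c ℕ.* suc q))))))
    (ℚᵘ.≃-trans (mkℚᵘ-cong (solve 3 (λ a c q → (a :* (con 1 :+ q) :+ c :* (con 1 :+ q)) :* (con 1 :+ q)
                                            := (a :+ c) :* (con 1 :+ (q :+ q :* (con 1 :+ q)))) refl a c q))
    (ℚᵘ.≃-sym (toℚᵘ-frac (a ℕ.+ c) q))))))

  1≡frac : ∀ q → 1ℚ ≡ frac (suc q) (suc q)
  1≡frac q = frac-cong {1} {0} {suc q} {q} (ℕ.*-comm 1 (suc q))

  0≡frac : ∀ q → 0ℚ ≡ frac 0 (suc q)
  0≡frac q = frac-cong {0} {0} {0} {q} refl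

  prodℚ-frac : (q : ℕ) (c : α → ℕ) (xs : List α) →
    ∃[ r ] suc q ^ length xs ≡ suc r ×
           prodℚ (map (λ x → frac (c x) (suc q)) xs) ≡ frac (product (map c xs)) (suc r)
  prodℚ-frac q c [] = 0 , refl , 1≡frac 0
  prodℚ-frac q c (x ∷ xs) with prodℚ-frac q c xs
  ... | r , qᵏ≡1+r , eq = r ℕ.+ q ℕ.* suc r , cong (suc q ℕ.*_) qᵏ≡1+r ,
    trans (cong (frac (c x) (suc q) *_) eq) (frac-* (c x) q (product (map c xs)) r)

  sumℚ-frac : (h : ℕ) (A : α → ℕ) (xs : List α) →
    sumℚ (map (λ x → frac (A x) (suc h)) xs) ≡ frac (sum (map A xs)) (suc h)
  sumℚ-frac h A [] = 0≡frac h
  sumℚ-frac h A (x ∷ xs) =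
    trans (cong (λ s → frac (A x) (suc h) + s) (sumℚ-frac h A xs)) (frac-+ (A x) (sum (map A xs)) h)

  sumℚ-mono : (f g : α → ℚ) (xs : List α) → (∀ {x} → x ∈ₗ xs → f x ≤ g x) → sumℚ (map f xs) ≤ sumℚ (map g xs)
  sumℚ-mono f g [] _ = ℚ.≤-refl
  sumℚ-mono f g (x ∷ xs) f≤g = ℚ.+-mono-≤ (f≤g (here refl)) (sumℚ-mono f g xs (f≤g ∘ there))

  1+Σ∏frac≤frac : {h Q S : ℕ} (L : List α) (M : List β) (c : α → β → ℕ) (A : α → ℕ) → 0 ℕ.< h → 0 ℕ.< Q →
    (∀ {Y} → Y ∈ₗ L → h ℕ.* product (map (c Y) M) ℕ.≤ A Y ℕ.* Q ^ length M) →
    h ℕ.+ sum (map A L) ℕ.≤ S →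
    1ℚ + sumℚ (map (λ Y → prodℚ (map (λ x → frac (c Y x) Q) M)) L) ≤ frac S h
  1+Σ∏frac≤frac {h = suc h} {suc q} {S} L M c A _ _ per-term total = begin
    1ℚ + sumℚ (map (λ Y → prodℚ (map (λ x → frac (c Y x) (suc q)) M)) L)
      ≤⟨ ℚ.+-mono-≤ (ℚ.≤-reflexive (1≡frac h)) (sumℚ-mono _ _ L term-bound) ⟩
    frac (suc h) (suc h) + sumℚ (map (λ Y → frac (A Y) (suc h)) L)
      ≡⟨ cong (λ s → frac (suc h) (suc h) + s) (sumℚ-frac h A L) ⟩
    frac (suc h) (suc h) + frac (sum (map A L)) (suc h)
      ≡⟨ frac-+ (suc h) (sum (map A L)) h ⟩
    frac (suc h ℕ.+ sum (map A L)) (suc h)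
      ≤⟨ frac-mono (suc h ℕ.+ sum (map A L)) h S h (ℕ.*-monoˡ-≤ (suc h) total) ⟩
    frac S (suc h) ∎
    where
    open ℚ.≤-Reasoning
    term-bound : ∀ {Y} → Y ∈ₗ L → prodℚ (map (λ x → frac (c Y x) (suc q)) M) ≤ frac (A Y) (suc h)
    term-bound {Y} Y∈L with prodℚ-frac q (c Y) M
    ... | r , qᵏ≡1+r , eq = ℚ.≤-trans (ℚ.≤-reflexive eq) (frac-mono (product (map (c Y) M)) r (A Y) h
      (subst₂ ℕ._≤_ (ℕ.*-comm (suc h) (product (map (c Y) M))) (cong (A Y ℕ.*_) qᵏ≡1+r) (per-term Y∈L)))

module UnionGenerators where

  open import Data.Bool using (Bool; true; false; _∧_; _∨_; not; T; T?)
  open import Data.Bool.Properties using (∧-conicalˡ; ∧-conicalʳ; not-¬; not-injective; ⇔→≡; T-≡)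
  open import Data.Bool.ListAction using (any; all)
  open import Data.Rational using () renaming (_≤_ to _≤ᵣ_)
  open import Data.Empty using (⊥-elim)
  open import Data.Fin using (Fin; _≟_)
  open import Data.Fin.Properties using (¬∀⟶∃¬)
  open import Data.Fin.Subset using (Subset; _∈_; _∉_; _⊆_; _⊂_; _∪_; _∩_; _─_; _-_; ⁅_⁆; ∣_∣) renaming (⊥ to ∅)
  open import Data.Fin.Subset.Properties
    using ( _∈?_; ∉⊥; x∈p∪q⁻; x∈p∪q⁺; x∈p∩q⁻; x∈p∩q⁺; p∩q⊆q; q⊆p∪q; ⊆-refl; ⊆-trans; ⊆-antisym
          ; p─q⊆p; x∈p∧x∉q⇒x∈p─q; x∈⁅x⁆; x∈⁅y⁆⇒x≡y; x∈p∧x≢y⇒x∈p-y; x∈p⇒∣p-x∣<∣p∣)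
  open import Data.Fin.Subset.Induction using (⊂-wellFounded)
  open import Data.List using (List; allFin; filter; map; length)
  open import Data.List.Properties using (map-cong; filter-≐)
  open import Data.Nat.ListAction using (sum; product)
  import Data.List.Relation.Unary.All as All
  open import Data.List.Membership.Propositional using () renaming (_∈_ to _∈ₗ_)
  open import Data.List.Membership.Propositional.Properties using (∈-allFin; ∈-filter⁺)
  open import Data.Nat using (ℕ; suc; _+_; _*_; _^_; _≤_; _<_; z≤n; s≤s)
  open import Data.Nat.Properties
    using (+-monoˡ-≤; *-monoˡ-≤; +-comm; ≤-trans; ≤-reflexive; <⇒≱; m^n>0; module ≤-Reasoning)
  open import Data.Product using (∃-syntax; _×_; _,_; proj₁)
  open import Data.Sum as Sum using (_⊎_; inj₁; inj₂; [_,_]′)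
  open import Function using (_∘_; id; flip; mk⇔; Equivalence)
  open Equivalence using (from)
  open import Induction.WellFounded using (Acc; acc)
  open import Relation.Nullary using (yes; no; ¬_; _→-dec_)
  open import Relation.Nullary.Decidable using (⌊_⌋; toWitness)
  open import Relation.Binary.PropositionalEquality using (_≡_; _≢_; refl; sym; cong; cong₂; subst)
  open import Defs
  open BooleanReflection
  open Counting
  open HarrisKleitman
  open Fractions

  private variable
    n : ℕ
    𝓕 : Fam n
    p q X Y : Subset n
    x : Fin n

  ∈π⁻ : x ∈ π 𝓕 p → ∃[ V ] 𝓕 V ≡ true × V ⊆ p × x ∈ V
  ∈π⁻ {𝓕 = 𝓕} {p} x∈ with ∈⋃⁻ (members (λ V → 𝓕 V ∧ (V ⊆ᵇ p))) x∈
  ... | V , V∈ , x∈V with ∈-members⁻ (λ V → 𝓕 V ∧ (V ⊆ᵇ p)) V∈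
  ...   | 𝓕V∧V⊆p = V , ∧-conicalˡ _ _ 𝓕V∧V⊆p , ⊆ᵇ⇒⊆ (∧-conicalʳ (𝓕 V) _ 𝓕V∧V⊆p) , x∈V

  member⊆π : {V : Subset n} → 𝓕 V ≡ true → V ⊆ p → V ⊆ π 𝓕 p
  member⊆π {𝓕 = 𝓕} {p} {V} 𝓕V V⊆p x∈V =
    ∈⋃⁺ (∈-members⁺ (λ V → 𝓕 V ∧ (V ⊆ᵇ p)) (cong₂ _∧_ 𝓕V (⊆⇒⊆ᵇ V⊆p))) x∈V

  π⊆ : π 𝓕 p ⊆ p
  π⊆ x∈ with ∈π⁻ x∈
  ... | _ , _ , V⊆p , x∈V = V⊆p x∈V

  π-mono : p ⊆ q → π 𝓕 p ⊆ π 𝓕 q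
  π-mono p⊆q x∈ with ∈π⁻ x∈
  ... | V , 𝓕V , V⊆p , x∈V = member⊆π 𝓕V (⊆-trans V⊆p p⊆q) x∈V

  π-squeeze : q ⊆ p → π 𝓕 p ⊆ q → π 𝓕 q ≡ π 𝓕 p
  π-squeeze {q = q} {p} {𝓕} q⊆p πp⊆q = ⊆-antisym (π-mono q⊆p) πp⊆πq
    where
    πp⊆πq : π 𝓕 p ⊆ π 𝓕 q
    πp⊆πq x∈ with ∈π⁻ {p = p} x∈
    ... | V , 𝓕V , V⊆p , x∈V = member⊆π 𝓕V (⊆-trans (member⊆π 𝓕V V⊆p) πp⊆q) x∈V

  E-intro : {U : Subset n} → Y ⊆ U → π 𝓕 (X ∪ Y) ∩ U ≡ Y → π 𝓕 (X ∪ U) ─ U ⊆ π 𝓕 (X ∪ Y) → E 𝓕 U X Y ≡ true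
  E-intro Y⊆U traceY πX∪U⊆ = cong₂ _∧_ (⊆⇒⊆ᵇ Y⊆U) (cong₂ _∧_ (≡⇒≡ᵇ traceY) (⊆⇒⊆ᵇ πX∪U⊆))

  E-self : {U : Subset n} → 𝓕 U ≡ true → E 𝓕 U X U ≡ true
  E-self {𝓕 = 𝓕} {X} {U} 𝓕U = E-intro {X = X} ⊆-refl
    (⊆-antisym (p∩q⊆q (π 𝓕 (X ∪ U)) U) (λ x∈U → x∈p∩q⁺ (member⊆π 𝓕U (q⊆p∪q X U) x∈U , x∈U)))
    (p─q⊆p (π 𝓕 (X ∪ U)) U)

  ⊂ᵇ-irrefl : (U : Subset n) → (U ⊂ᵇ U) ≡ false
  ⊂ᵇ-irrefl U rewrite ⊆⇒⊆ᵇ (⊆-refl {x = U}) | ≡⇒≡ᵇ {p = U} refl = refl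

  card-E-lower : {U : Subset n} → 𝓕 U ≡ true → suc (count (E 𝓕 U X) (members (_⊂ᵇ U))) ≤ card (E 𝓕 U X)
  card-E-lower {n} {𝓕} {X} {U} 𝓕U = begin
    suc proper                        ≤⟨ +-monoˡ-≤ proper (count-pos improper (∈-allSubsets U) U-improper) ⟩
    count improper (allSubsets n) + proper ≡⟨ +-comm (count improper (allSubsets n)) proper ⟩
    proper + count improper (allSubsets n) ≡⟨ count-partition (E 𝓕 U X) (_⊂ᵇ U) (allSubsets n) ⟨
    count (E 𝓕 U X) (allSubsets n)     ≡⟨ length-filter (E 𝓕 U X) (allSubsets n) ⟨
    card (E 𝓕 U X)                     ∎
    where
    open ≤-Reasoning
    proper = count (E 𝓕 U X) (members (_⊂ᵇ U))
    improper : Subset n → Bool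
    improper Y = E 𝓕 U X Y ∧ not (Y ⊂ᵇ U)
    U-improper : improper U ≡ true
    U-improper = cong₂ _∧_ (E-self {X = X} 𝓕U) (cong not (⊂ᵇ-irrefl U))

  ⊆∧≢⇒⊂ : Y ⊆ X → Y ≢ X → Y ⊂ X
  ⊆∧≢⇒⊂ {n} {Y} {X} Y⊆X Y≢X with ¬∀⟶∃¬ n (λ x → x ∈ X → x ∈ Y) (λ x → (x ∈? X) →-dec (x ∈? Y))
                                          (λ X⊆Y → Y≢X (⊆-antisym Y⊆X (λ {x} → X⊆Y x)))
  ... | x , ¬[x∈X⇒x∈Y] with x ∈? X
  ...   | yes x∈X = Y⊆X , x , x∈X , (λ x∈Y → ¬[x∈X⇒x∈Y] (λ _ → x∈Y))
  ...   | no x∉X = ⊥-elim (¬[x∈X⇒x∈Y] (⊥-elim ∘ x∉X))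

  ⊂ᵇ⇒⊂ : (Y ⊂ᵇ X) ≡ true → Y ⊂ X
  ⊂ᵇ⇒⊂ {Y = Y} {X} Y⊂ᵇX = ⊆∧≢⇒⊂ (⊆ᵇ⇒⊆ (∧-conicalˡ _ _ Y⊂ᵇX))
    (λ Y≡X → not-¬ (≡⇒≡ᵇ Y≡X) (not-injective (∧-conicalʳ (Y ⊆ᵇ X) _ Y⊂ᵇX)))

  ⊂⇒⊂ᵇ : Y ⊆ X → Y ≢ X → (Y ⊂ᵇ X) ≡ true
  ⊂⇒⊂ᵇ {Y = Y} {X} Y⊆X Y≢X with Y ≡ᵇ X in Y≡ᵇX
  ... | true = ⊥-elim (Y≢X (≡ᵇ⇒≡ Y≡ᵇX))
  ... | false = cong (_∧ true) (⊆⇒⊆ᵇ Y⊆X)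

  Minimal : Fam n → Subset n → Set
  Minimal {n} H X = ∀ Y → H Y ≡ true → (Y ⊆ᵇ X) ≡ true → Y ≡ X

  minimal-below : (H : Fam n) → H X ≡ true → ∃[ X₀ ] X₀ ⊆ X × H X₀ ≡ true × Minimal H X₀
  minimal-below {n} H = go (⊂-wellFounded _)
    where
    go : ∀ {X} → Acc _⊂_ X → H X ≡ true → ∃[ X₀ ] X₀ ⊆ X × H X₀ ≡ true × Minimal H X₀
    go {X} (acc below) HX with any (λ Y → H Y ∧ (Y ⊂ᵇ X)) (allSubsets n) in smaller
    ... | true with any-true⁻ _ (allSubsets n) smaller
    ...   | Y , _ , HY∧Y⊂X with ⊂ᵇ⇒⊂ (∧-conicalʳ (H Y) _ HY∧Y⊂X)
    ...     | Y⊂X with go (below Y⊂X) (∧-conicalˡ _ _ HY∧Y⊂X)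
    ...       | X₀ , X₀⊆Y , HX₀ , min = X₀ , ⊆-trans X₀⊆Y (proj₁ Y⊂X) , HX₀ , min
    go {X} _ HX | false = X , ⊆-refl , HX , minimal
      where
      minimal : Minimal H X
      minimal Y HY Y⊆X with Y ≡ᵇ X in Y≡ᵇX
      ... | true = ≡ᵇ⇒≡ Y≡ᵇX
      ... | false = ⊥-elim (not-¬ smaller (any-true⁺ _ (∈-allSubsets Y)
                      (cong₂ _∧_ HY (cong₂ _∧_ Y⊆X (cong not Y≡ᵇX)))))

  at-most-two : {e : Subset n} {i j k : Fin n} → ∣ e ∣ ≤ 2 → i ∈ e → j ∈ e → i ≢ j → k ∈ e → k ≡ i ⊎ k ≡ j
  at-most-two {e = e} {i} {j} {k} ∣e∣≤2 i∈e j∈e i≢j k∈e with k ≟ i | k ≟ j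
  ... | yes k≡i | _ = inj₁ k≡i
  ... | no _ | yes k≡j = inj₂ k≡j
  ... | no k≢i | no k≢j = ⊥-elim (<⇒≱ (s≤s (s≤s (s≤s z≤n))) (≤-trans three≤∣e∣ ∣e∣≤2))
    where
    j∈e-i = x∈p∧x≢y⇒x∈p-y j∈e (i≢j ∘ sym)
    k∈e-i-j = x∈p∧x≢y⇒x∈p-y (x∈p∧x≢y⇒x∈p-y k∈e k≢i) k≢j
    three≤∣e∣ : 3 ≤ ∣ e ∣
    three≤∣e∣ = ≤-trans (s≤s (s≤s (≤-trans (s≤s z≤n) (x∈p⇒∣p-x∣<∣p∣ k∈e-i-j))))
                  (≤-trans (s≤s (x∈p⇒∣p-x∣<∣p∣ j∈e-i)) (x∈p⇒∣p-x∣<∣p∣ i∈e))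

  Covered : Fam n → Subset n → Fin n → Set
  Covered {n} 𝓕 p x = ∃[ V ] J 𝓕 V ≡ true × V ⊆ p × x ∈ V

  covered⇒∈π : Covered 𝓕 p x → x ∈ π 𝓕 p
  covered⇒∈π (V , JV , V⊆p , x∈V) = member⊆π (∧-conicalˡ _ _ JV) V⊆p x∈V

  module _ {𝓕 : Fam n} {U Y : Subset n} {x : Fin n} where

    ℰ⇒covered : x ∈ X → ℰ 𝓕 U Y x X ≡ true → Covered 𝓕 (X ∪ Y) x
    ℰ⇒covered {X} x∈X ℰX with any-true⁻ _ (allFin n) (∧-conicalʳ (X ⊆ᵇ N²∖ 𝓕 U) _ ℰX)
    ... | y , _ , Jxy∧y∈ = ⁅ x ⁆ ∪ ⁅ y ⁆ , ∧-conicalˡ _ _ Jxy∧y∈ , pair⊆ , x∈p∪q⁺ (inj₁ (x∈⁅x⁆ x))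
      where
      x∈X∪Y = x∈p∪q⁺ (inj₁ x∈X)
      y∈X∪Y : y ∈ X ∪ Y
      y∈X∪Y with ∨-true⁻ (∧-conicalʳ (J 𝓕 (⁅ x ⁆ ∪ ⁅ y ⁆)) _ Jxy∧y∈)
      ... | inj₁ y∈ = ∈ᵇ⇒∈ y∈
      ... | inj₂ y≟x = subst (_∈ X ∪ Y) (sym (toWitness (from T-≡ y≟x))) x∈X∪Y
      pair⊆ : ⁅ x ⁆ ∪ ⁅ y ⁆ ⊆ X ∪ Y
      pair⊆ z∈ with x∈p∪q⁻ ⁅ x ⁆ ⁅ y ⁆ z∈
      ... | inj₁ z∈⁅x⁆ rewrite x∈⁅y⁆⇒x≡y x z∈⁅x⁆ = x∈X∪Y
      ... | inj₂ z∈⁅y⁆ rewrite x∈⁅y⁆⇒x≡y y z∈⁅y⁆ = y∈X∪Y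

    ℰ-upSetIn : UpSetIn (N²∖ 𝓕 U) (ℰ 𝓕 U Y x)
    ℰ-upSetIn = record
      { bounded = λ {X} ℰX → ⊆ᵇ⇒⊆ (∧-conicalˡ _ _ ℰX)
      ; upward = upward
      }
      where
      upward : UpwardClosedIn (N²∖ 𝓕 U) (ℰ 𝓕 U Y x)
      upward {X} {X'} ℰX X⊆X' X'⊆D with any-true⁻ _ (allFin n) (∧-conicalʳ (X ⊆ᵇ N²∖ 𝓕 U) _ ℰX)
      ... | y , _ , Jxy∧y∈ = cong₂ _∧_ (⊆⇒⊆ᵇ X'⊆D) (any-true⁺ _ (∈-allFin y)
            (cong₂ _∧_ (∧-conicalˡ _ _ Jxy∧y∈) (y-ok (∨-true⁻ (∧-conicalʳ (J 𝓕 (⁅ x ⁆ ∪ ⁅ y ⁆)) _ Jxy∧y∈)))))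
        where
        y-ok : (y ∈ᵇ (X ∪ Y)) ≡ true ⊎ ⌊ y ≟ x ⌋ ≡ true → ((y ∈ᵇ (X' ∪ Y)) ∨ ⌊ y ≟ x ⌋) ≡ true
        y-ok (inj₁ y∈) = cong (_∨ _) (∈⇒∈ᵇ ([ x∈p∪q⁺ ∘ inj₁ ∘ X⊆X' , x∈p∪q⁺ ∘ inj₂ ]′ (x∈p∪q⁻ X Y (∈ᵇ⇒∈ y∈))))
        y-ok (inj₂ y≡x) = ∨-trueʳ _ y≡x

  module Setting {n : ℕ} (𝓕 : Fam n) (a b : Fin n)
    (edge-size : ∀ {V} → J 𝓕 V ≡ true → ∣ V ∣ ≡ 1 ⊎ ∣ V ∣ ≡ 2)
    (U-edge : J 𝓕 (pair a b) ≡ true)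
    (generated : ∀ {A} → 𝓕 A ≡ true → 𝒩³ 𝓕 (pair a b) A)
    where

    U : Subset n
    U = pair a b

    edge-size≤2 : ∀ {V} → J 𝓕 V ≡ true → ∣ V ∣ ≤ 2
    edge-size≤2 JV = [ (λ ∣V∣≡1 → ≤-trans (≤-reflexive ∣V∣≡1) (s≤s z≤n)) , ≤-reflexive ]′ (edge-size JV)

    W : Subset n
    W = ⋃ (members (λ V → J 𝓕 V ∧ meetsᵇ V U))

    edge-decomposition : ∀ {A x} → 𝓕 A ≡ true → x ∈ A → ∃[ V ] (J 𝓕 V ∧ meetsᵇ V W) ≡ true × V ⊆ A × x ∈ V
    edge-decomposition 𝓕A x∈A with generated 𝓕A
    ... | Vs , Vs-edges , refl with ∈⋃⁻ Vs x∈A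
    ...   | V , V∈Vs , x∈V = V , All.lookup Vs-edges V∈Vs , ∈⋃⁺ V∈Vs , x∈V

    ∈π⇒covered : ∀ {S x} → x ∈ π 𝓕 S → Covered 𝓕 S x
    ∈π⇒covered {S} x∈πS with ∈π⁻ {p = S} x∈πS
    ... | A , 𝓕A , A⊆S , x∈A with edge-decomposition 𝓕A x∈A
    ...   | V , JV∧meets , V⊆A , x∈V = V , ∧-conicalˡ _ _ JV∧meets , ⊆-trans V⊆A A⊆S , x∈V

    member⊆N² : ∀ {A} → 𝓕 A ≡ true → A ⊆ Nb 𝓕 (Nb 𝓕 U)
    member⊆N² 𝓕A x∈A with edge-decomposition 𝓕A x∈A
    ... | V , JV∧meets , _ , x∈V with meetsᵇ⇒ (∧-conicalʳ (J 𝓕 V) _ JV∧meets)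
    ...   | y , y∈V , y∈W = x∈p∪q⁺ (inj₂ (∈⋃⁺ (∈-members⁺ (λ V → J 𝓕 V ∧ meetsᵇ V (Nb 𝓕 U))
              (cong₂ _∧_ (∧-conicalˡ _ _ JV∧meets) (meetsᵇ⇐ y∈V (x∈p∪q⁺ (inj₂ y∈W))))) x∈V))

    D : Subset n
    D = N²∖ 𝓕 U

    ∈N─U : ∀ {e z} → J 𝓕 e ≡ true → meetsᵇ e U ≡ true → z ∈ e → z ∉ U → z ∈ Nb 𝓕 U ─ U
    ∈N─U Je meets z∈e z∉U = x∈p∧x∉q⇒x∈p─q
      (x∈p∪q⁺ (inj₂ (∈⋃⁺ (∈-members⁺ (λ V → J 𝓕 V ∧ meetsᵇ V U) (cong₂ _∧_ Je meets)) z∈e))) z∉U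

    covered-avoiding : ∀ {X₀ X u z} → X₀ ⊆ X → u ∈ U → u ∉ π 𝓕 (X ∪ ⁅ u ⁆) → z ∉ U →
      Covered 𝓕 (X₀ ∪ U) z → Covered 𝓕 (X₀ ∪ (U - u)) z
    covered-avoiding {X₀} {X} {u} {z} X₀⊆X u∈U u∉π z∉U (e , Je , e⊆X₀∪U , z∈e) = e , Je , e⊆ , z∈e
      where
      z∈X₀ : z ∈ X₀
      z∈X₀ = [ id , ⊥-elim ∘ z∉U ]′ (x∈p∪q⁻ X₀ U (e⊆X₀∪U z∈e))
      e⊆X∪u : u ∈ e → e ⊆ X ∪ ⁅ u ⁆
      e⊆X∪u u∈e k∈e with at-most-two (edge-size≤2 Je) z∈e u∈e (λ z≡u → z∉U (subst (_∈ U) (sym z≡u) u∈U)) k∈e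
      ... | inj₁ refl = x∈p∪q⁺ (inj₁ (X₀⊆X z∈X₀))
      ... | inj₂ refl = x∈p∪q⁺ (inj₂ (x∈⁅x⁆ u))
      e⊆ : e ⊆ X₀ ∪ (U - u)
      e⊆ {k} k∈e with x∈p∪q⁻ X₀ U (e⊆X₀∪U k∈e)
      ... | inj₁ k∈X₀ = x∈p∪q⁺ (inj₁ k∈X₀)
      ... | inj₂ k∈U with k ≟ u
      ...   | no k≢u = x∈p∪q⁺ (inj₂ (x∈p∧x≢y⇒x∈p-y k∈U k≢u))
      ...   | yes refl = ⊥-elim (u∉π (covered⇒∈π (e , Je , e⊆X∪u k∈e , k∈e)))

    module _ (H : Fam n) (H-upSet : UpSetIn D H) where

      open UpSetIn H-upSet renaming (bounded to H⊆D; upward to H-upward)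

      H-avoids-U : ∀ {X x} → H X ≡ true → x ∈ X → x ∉ U
      H-avoids-U HX x∈X = x∈p─q⇒x∉q _ U (H⊆D HX x∈X)

      join∖U≗H : 𝓕 ∅ ≡ true → ∀ C → ((𝓕 ∨ᶠ H) ∖ᶠ U) C ≡ H C
      join∖U≗H ∅∈𝓕 C = ⇔→≡ (mk⇔ join⇒H H⇒join)
        where
        join⇒H : ((𝓕 ∨ᶠ H) ∖ᶠ U) C ≡ true → H C ≡ true
        join⇒H C∈ with any-true⁻ _ (members (𝓕 ∨ᶠ H)) C∈
        ... | A , A∈ , C≡A─U with any-true⁻ _ (members 𝓕) (∈-members⁻ (𝓕 ∨ᶠ H) A∈)
        ... | A′ , A′∈ , A∈A′∨H with any-true⁻ _ (members H) A∈A′∨H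
        ... | B , B∈ , A≡A′∪B rewrite ≡ᵇ⇒≡ C≡A─U | ≡ᵇ⇒≡ A≡A′∪B = H-upward HB B⊆ ⊆D
          where
          HB = ∈-members⁻ H B∈
          B⊆ : B ⊆ (A′ ∪ B) ─ U
          B⊆ x∈B = x∈p∧x∉q⇒x∈p─q (x∈p∪q⁺ (inj₂ x∈B)) (H-avoids-U HB x∈B)
          ⊆D : (A′ ∪ B) ─ U ⊆ D
          ⊆D x∈ with x∈p∪q⁻ A′ B (p─q⊆p _ U x∈)
          ... | inj₁ x∈A′ = x∈p∧x∉q⇒x∈p─q (member⊆N² (∈-members⁻ 𝓕 A′∈) x∈A′) (x∈p─q⇒x∉q _ U x∈)
          ... | inj₂ x∈B = H⊆D HB x∈B
        H⇒join : H C ≡ true → ((𝓕 ∨ᶠ H) ∖ᶠ U) C ≡ true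
        H⇒join HC = any-true⁺ _ (∈-members⁺ (𝓕 ∨ᶠ H) ∅∪C∈) (≡⇒≡ᵇ (⊆-antisym C⊆ ⊆C))
          where
          ∅∪C∈ : (𝓕 ∨ᶠ H) (∅ ∪ C) ≡ true
          ∅∪C∈ = any-true⁺ _ (∈-members⁺ 𝓕 ∅∈𝓕) (any-true⁺ _ (∈-members⁺ H HC) (≡⇒≡ᵇ refl))
          C⊆ : C ⊆ (∅ ∪ C) ─ U
          C⊆ x∈C = x∈p∧x∉q⇒x∈p─q (x∈p∪q⁺ (inj₂ x∈C)) (H-avoids-U HC x∈C)
          ⊆C : (∅ ∪ C) ─ U ⊆ C
          ⊆C x∈ = [ ⊥-elim ∘ ∉⊥ , id ]′ (x∈p∪q⁻ ∅ C (p─q⊆p _ U x∈))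

      module _ (minimal⇒|E|≡1 : ∀ {X} → H X ≡ true → Minimal H X → card (E 𝓕 U X) ≡ 1) where

        proper-E-member : ∀ {X₀ X u} → H X₀ ≡ true → X₀ ⊆ X → u ∈ U → u ∉ π 𝓕 (X ∪ ⁅ u ⁆) →
          ∃[ Y ] (Y ⊂ᵇ U) ≡ true × E 𝓕 U X₀ Y ≡ true
        proper-E-member {X₀} {X} {u} HX₀ X₀⊆X u∈U u∉π =
          Y₀ , ⊂⇒⊂ᵇ (p∩q⊆q (π 𝓕 S) U) Y₀≢U ,
          E-intro {X = X₀} (p∩q⊆q (π 𝓕 S) U) (cong (_∩ U) πX₀∪Y₀≡πS)
            (subst (π 𝓕 (X₀ ∪ U) ─ U ⊆_) (sym πX₀∪Y₀≡πS) πX₀∪U─U⊆πS)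
          where
          S = X₀ ∪ (U - u)
          Y₀ = π 𝓕 S ∩ U
          πX₀∪Y₀≡πS : π 𝓕 (X₀ ∪ Y₀) ≡ π 𝓕 S
          πX₀∪Y₀≡πS = π-squeeze X₀∪Y₀⊆S πS⊆X₀∪Y₀
            where
            X₀∪Y₀⊆S : X₀ ∪ Y₀ ⊆ S
            X₀∪Y₀⊆S z∈ = [ x∈p∪q⁺ ∘ inj₁ , π⊆ ∘ proj₁ ∘ x∈p∩q⁻ (π 𝓕 S) U ]′ (x∈p∪q⁻ X₀ Y₀ z∈)
            πS⊆X₀∪Y₀ : π 𝓕 S ⊆ X₀ ∪ Y₀
            πS⊆X₀∪Y₀ z∈ = x∈p∪q⁺ (Sum.map₂ (λ z∈U-u → x∈p∩q⁺ (z∈ , p─q⊆p U ⁅ u ⁆ z∈U-u))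
                                               (x∈p∪q⁻ X₀ (U - u) (π⊆ z∈)))
          Y₀≢U : Y₀ ≢ U
          Y₀≢U Y₀≡U with x∈p∪q⁻ X₀ (U - u) (π⊆ (proj₁ (x∈p∩q⁻ (π 𝓕 S) U (subst (u ∈_) (sym Y₀≡U) u∈U))))
          ... | inj₁ u∈X₀ = H-avoids-U HX₀ u∈X₀ u∈U
          ... | inj₂ u∈U-u = x∈p─q⇒x∉q U ⁅ u ⁆ u∈U-u (x∈⁅x⁆ u)
          πX₀∪U─U⊆πS : π 𝓕 (X₀ ∪ U) ─ U ⊆ π 𝓕 S
          πX₀∪U─U⊆πS z∈ = covered⇒∈π (covered-avoiding X₀⊆X u∈U u∉π (x∈p─q⇒x∉q _ U z∈)
                                         (∈π⇒covered (p─q⊆p _ U z∈)))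

        U-covered : ∀ {X u} → H X ≡ true → u ∈ U → Covered 𝓕 (X ∪ ⁅ u ⁆) u
        U-covered {X} {u} HX u∈U with u ∈? π 𝓕 (X ∪ ⁅ u ⁆)
        ... | yes u∈π = ∈π⇒covered u∈π
        ... | no u∉π with minimal-below H HX
        ...   | X₀ , X₀⊆X , HX₀ , minimal with proper-E-member HX₀ X₀⊆X u∈U u∉π
        ...     | Y , Y⊂U , Y∈E = ⊥-elim (<⇒≱ 2≤|E| (≤-reflexive (minimal⇒|E|≡1 HX₀ minimal)))
          where
          2≤|E| = ≤-trans (s≤s (count-pos (E 𝓕 U X₀) (∈-members⁺ (_⊂ᵇ U) Y⊂U) Y∈E))
                          (card-E-lower {X = X₀} (∧-conicalˡ _ _ U-edge))

        E-of-ℰ : ∀ {X Y} → Y ⊆ U → H X ≡ true → (∀ {x} → x ∈ Nb 𝓕 U ─ U → ℰ 𝓕 U Y x X ≡ true) →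
          E 𝓕 U X Y ≡ true
        E-of-ℰ {X} {Y} Y⊆U HX ℰ-all = E-intro {X = X} Y⊆U (⊆-antisym trace⊆Y Y⊆trace) πX∪U─U⊆
          where
          trace⊆Y : π 𝓕 (X ∪ Y) ∩ U ⊆ Y
          trace⊆Y z∈ with x∈p∩q⁻ (π 𝓕 (X ∪ Y)) U z∈
          ... | z∈π , z∈U = [ ⊥-elim ∘ flip (H-avoids-U HX) z∈U , id ]′ (x∈p∪q⁻ X Y (π⊆ z∈π))
          Y⊆trace : Y ⊆ π 𝓕 (X ∪ Y) ∩ U
          Y⊆trace {z} z∈Y with U-covered HX (Y⊆U z∈Y)
          ... | e , Je , e⊆X∪z , z∈e = x∈p∩q⁺ (covered⇒∈π (e , Je , e⊆X∪Y , z∈e) , Y⊆U z∈Y)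
            where
            e⊆X∪Y : e ⊆ X ∪ Y
            e⊆X∪Y k∈e = x∈p∪q⁺ (Sum.map₂ (λ k∈⁅z⁆ → subst (_∈ Y) (sym (x∈⁅y⁆⇒x≡y z k∈⁅z⁆)) z∈Y)
                                          (x∈p∪q⁻ X ⁅ z ⁆ (e⊆X∪z k∈e)))
          πX∪U─U⊆ : π 𝓕 (X ∪ U) ─ U ⊆ π 𝓕 (X ∪ Y)
          πX∪U─U⊆ {z} z∈ with ∈π⇒covered (p─q⊆p _ U z∈)
          ... | e , Je , e⊆X∪U , z∈e with meetsᵇ e U in meets
          ...   | true = covered⇒∈π (ℰ⇒covered {𝓕 = 𝓕} {U = U} z∈X (ℰ-all (∈N─U Je meets z∈e z∉U)))
            where
            z∉U = x∈p─q⇒x∉q _ U z∈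
            z∈X = [ id , ⊥-elim ∘ z∉U ]′ (x∈p∪q⁻ X U (e⊆X∪U z∈e))
          ...   | false = covered⇒∈π (e , Je , e⊆X∪Y , z∈e)
            where
            e⊆X∪Y : e ⊆ X ∪ Y
            e⊆X∪Y k∈e = x∈p∪q⁺ (inj₁ ([ id , (λ k∈U → ⊥-elim (not-¬ meets (meetsᵇ⇐ k∈e k∈U))) ]′
                                          (x∈p∪q⁻ X U (e⊆X∪U k∈e))))

        Ys⊊U : List (Subset n)
        Ys⊊U = members (_⊂ᵇ U)

        xs∈N∖U : List (Fin n)
        xs∈N∖U = filter (λ x → T? (x ∈ᵇ (Nb 𝓕 U ─ U))) (allFin n)

        hits : Subset n → ℕ
        hits Y = count (λ X → E 𝓕 U X Y) (members H)

        Σ|E|-lower : card H + sum (map hits Ys⊊U) ≤ sum (map (λ X → card (E 𝓕 U X)) (members H))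
        Σ|E|-lower = begin
          card H + sum (map hits Ys⊊U)
            ≡⟨ cong₂ _+_ (sum-map-one (members H)) (count-swap (λ X Y → E 𝓕 U X Y) (members H) Ys⊊U) ⟨
          sum (map (λ _ → 1) (members H)) + sum (map (λ X → count (E 𝓕 U X) Ys⊊U) (members H))
            ≡⟨ sum-map-+ (λ _ → 1) (λ X → count (E 𝓕 U X) Ys⊊U) (members H) ⟨
          sum (map (λ X → suc (count (E 𝓕 U X) Ys⊊U)) (members H))
            ≤⟨ sum-map-mono _ _ (λ X → card-E-lower {X = X} (∧-conicalˡ _ _ U-edge)) (members H) ⟩
          sum (map (λ X → card (E 𝓕 U X)) (members H)) ∎
          where open ≤-Reasoning

        harris-bound : ∀ {Y} → Y ∈ₗ Ys⊊U →
          card H * product (map (λ x → card (ℰ 𝓕 U Y x)) xs∈N∖U) ≤ hits Y * (2 ^ ∣ D ∣) ^ length xs∈N∖U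
        harris-bound {Y} Y∈Ys⊊U = begin
          card H * product (map (λ x → card (ℰ 𝓕 U Y x)) xs∈N∖U)
            ≡⟨ cong₂ _*_ (length-filter H (allSubsets n))
                         (cong product (map-cong (λ x → length-filter (ℰ 𝓕 U Y x) (allSubsets n)) xs∈N∖U)) ⟩
          # H * product (map (λ x → # (ℰ 𝓕 U Y x)) xs∈N∖U)
            ≤⟨ harris-kleitman-all (λ x → ℰ-upSetIn {𝓕 = 𝓕} {U = U} {Y = Y} {x = x}) H-upSet xs∈N∖U ⟩
          # (λ X → H X ∧ all (λ x → ℰ 𝓕 U Y x X) xs∈N∖U) * Qᵏ
            ≤⟨ *-monoˡ-≤ Qᵏ (count-mono _ _ ℰ⇒E (allSubsets n)) ⟩
          # (λ X → H X ∧ E 𝓕 U X Y) * Qᵏ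
            ≡⟨ cong (_* Qᵏ) (count-filter (λ X → E 𝓕 U X Y) H (allSubsets n)) ⟨
          hits Y * Qᵏ ∎
          where
          open ≤-Reasoning
          Qᵏ = (2 ^ ∣ D ∣) ^ length xs∈N∖U
          Y⊆U : Y ⊆ U
          Y⊆U = ⊆ᵇ⇒⊆ (∧-conicalˡ _ _ (∈-members⁻ (_⊂ᵇ U) Y∈Ys⊊U))
          ℰ⇒E : ∀ X → (H X ∧ all (λ x → ℰ 𝓕 U Y x X) xs∈N∖U) ≡ true → (H X ∧ E 𝓕 U X Y) ≡ true
          ℰ⇒E X HX∧ℰ = cong₂ _∧_ HX (E-of-ℰ Y⊆U HX λ {x} x∈N─U →
            all-true⁻ _ xs∈N∖U (∧-conicalʳ (H X) _ HX∧ℰ) (∈-filter⁺ _ (∈-allFin x) (from T-≡ (∈⇒∈ᵇ x∈N─U))))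
            where HX = ∧-conicalˡ _ _ HX∧ℰ

        rhs≤μ : 𝓕 ∅ ≡ true → ∃[ X ] H X ≡ true → rhs 𝓕 U ≤ᵣ μ 𝓕 (𝓕 ∨ᶠ H) U
        rhs≤μ ∅∈𝓕 (X , HX) =
          subst (λ Xs → rhs 𝓕 U ≤ᵣ frac (sum (map (λ X → card (E 𝓕 U X)) Xs)) (length Xs)) (sym members-join∖U)
            (1+Σ∏frac≤frac Ys⊊U xs∈N∖U (λ Y x → card (ℰ 𝓕 U Y x)) hits
                           card-H>0 (m^n>0 2 ∣ D ∣) harris-bound Σ|E|-lower)
          where
          members-join∖U : members ((𝓕 ∨ᶠ H) ∖ᶠ U) ≡ members H
          members-join∖U = filter-≐ (T? ∘ (𝓕 ∨ᶠ H) ∖ᶠ U) (T? ∘ H)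
            ((λ {C} → subst T (join∖U≗H ∅∈𝓕 C)) , (λ {C} → subst T (sym (join∖U≗H ∅∈𝓕 C)))) (allSubsets n)
          card-H>0 : 0 < card H
          card-H>0 = subst (0 <_) (sym (length-filter H (allSubsets n))) (count-pos H (∈-allSubsets X) HX)


open import Defs
open import Data.Bool using (true)
open import Data.Nat using (ℕ)
open import Data.Fin using (Fin)
open import Data.Fin.Subset using (Subset; _∪_; ∣_∣) renaming (⊥ to ∅)
open import Data.Sum using (_⊎_)
open import Data.Product using (Σ; _×_; proj₁)
open import Data.Rational using (_≤_)
open import Relation.Binary.PropositionalEquality using (_≡_; _≢_)
open BooleanReflection using (⊆ᵇ⇒⊆; ⊆⇒⊆ᵇ)
open HarrisKleitman using (UpSetIn)
open UnionGenerators using (module Setting)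

theorem3p26 : (n : ℕ) (𝓕 : Fam n)
  → (∀ A B → 𝓕 A ≡ true → 𝓕 B ≡ true → 𝓕 (A ∪ B) ≡ true)
  → 𝓕 ∅ ≡ true
  → (∀ V → J 𝓕 V ≡ true → (∣ V ∣ ≡ 1) ⊎ (∣ V ∣ ≡ 2))
  → (a b : Fin n) → a ≢ b → J 𝓕 (pair a b) ≡ true
  → (∀ A → (𝓕 A ≡ true → 𝒩³ 𝓕 (pair a b) A) × (𝒩³ 𝓕 (pair a b) A → 𝓕 A ≡ true))
  → (𝓗 : Fam n)
  → (∀ X → 𝓗 X ≡ true → (X ⊆ᵇ N²∖ 𝓕 (pair a b)) ≡ true)
  → (∀ X Y → 𝓗 X ≡ true → (X ⊆ᵇ Y) ≡ true → (Y ⊆ᵇ N²∖ 𝓕 (pair a b)) ≡ true → 𝓗 Y ≡ true)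
  → Σ (Subset n) (λ X → 𝓗 X ≡ true)
  → (∀ X → 𝓗 X ≡ true → (∀ Y → 𝓗 Y ≡ true → (Y ⊆ᵇ X) ≡ true → Y ≡ X)
       → card (E 𝓕 (pair a b) X) ≡ 1)
  → rhs 𝓕 (pair a b) ≤ μ 𝓕 (𝓕 ∨ᶠ 𝓗) (pair a b)
theorem3p26 n 𝓕 _ ∅∈𝓕 edge-size a b _ U-edge 𝓕≡𝒩³ 𝓗 𝓗⊆D 𝓗-upward 𝓗-nonempty minimal⇒|E|≡1 =
  Setting.rhs≤μ 𝓕 a b (edge-size _) U-edge (proj₁ (𝓕≡𝒩³ _)) 𝓗 𝓗-upSet (minimal⇒|E|≡1 _) ∅∈𝓕 𝓗-nonempty
  where
  𝓗-upSet : UpSetIn (N²∖ 𝓕 (pair a b)) 𝓗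
  𝓗-upSet = record
    { bounded = λ 𝓗X → ⊆ᵇ⇒⊆ (𝓗⊆D _ 𝓗X)
    ; upward = λ 𝓗X X⊆Y Y⊆D → 𝓗-upward _ _ 𝓗X (⊆⇒⊆ᵇ X⊆Y) (⊆⇒⊆ᵇ Y⊆D)
    }
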